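{- Let $2 \leq m \leq n$ be integers and let $P_m, P_n$ denote the paths on $m$ and $n$ vertices. Then $\sigma(P_m \boxtimes P_n) = 5$ if $m \geq 4$; $\sigma(P_m \boxtimes P_n) = 4$ if $m = 3$, or if $m = 2$ and $n \geq 4$; and $\sigma(P_m \boxtimes P_n) = 3$ if $m = 2$ and $n \leq 3$.
   Context: Surrounding Cops and Robbers on a finite simple graph $G$ with $k \geq 1$ cops and one robber: the cops first choose starting vertices (several cops may share a vertex), then the robber chooses a starting vertex not occupied by a cop, and thereafter the cops and the robber alternate moves, the cops moving first. In a move, each player may move to an adjacent vertex or stay put; the robber may never move to, or remain on, a vertex occupied by a cop, so if a cop moves onto the robber's vertex the robber is compelled to move to a neighbouring vertex not occupied by a cop. The cops win if at any time every neighbour of the robber's vertex is occupied by a cop; the robber wins if he avoids this forever. Play is with perfect information. The surrounding cop number $\sigma(G)$ is the least number of cops for which the cops have a winning strategy. The strong product $G \boxtimes H$ has vertex set $V(G)\times V(H)$, with distinct $(g,h)$ and $(g',h')$ adjacent iff ($g=g'$ or $gg'\in E(G)$) and ($h=h'$ or $hh'\in E(H)$). -}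

module Defs where

open import Data.Nat using (ℕ; suc; _≤_; _<_)
open import Data.Nat.Properties using (1+n≢n)
open import Data.Fin using (Fin; toℕ)
open import Data.Product using (Σ; _×_; _,_; proj₁; proj₂)
open import Data.Sum using (_⊎_; inj₁; inj₂)
open import Relation.Nullary using (¬_)
open import Relation.Binary.PropositionalEquality using (_≡_; refl; sym; cong)

record Graph : Set₁ where
  field
    V         : Set
    Adj       : V → V → Set
    Adj-sym   : ∀ {u v} → Adj u v → Adj v u
    Adj-irrefl : ∀ {u} → ¬ Adj u u
open Graph public

PathAdj : ∀ {n} → Fin n → Fin n → Set
PathAdj i j = (suc (toℕ i) ≡ toℕ j) ⊎ (suc (toℕ j) ≡ toℕ i)

Path : ℕ → Graph
Path n = record
  { V = Fin n
  ; Adj = PathAdj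
  ; Adj-sym = λ { (inj₁ e) → inj₂ e ; (inj₂ e) → inj₁ e }
  ; Adj-irrefl = λ { (inj₁ e) → 1+n≢n e ; (inj₂ e) → 1+n≢n e }
  }

EqOrAdj : (G : Graph) → V G → V G → Set
EqOrAdj G u v = (u ≡ v) ⊎ Adj G u v

_⊠_ : Graph → Graph → Graph
G ⊠ H = record
  { V = V G × V H
  ; Adj = λ p q → (¬ p ≡ q) × EqOrAdj G (proj₁ p) (proj₁ q) × EqOrAdj H (proj₂ p) (proj₂ q)
  ; Adj-sym = λ { (ne , a , b) → (λ e → ne (sym e)) , flipG a , flipH b }
  ; Adj-irrefl = λ { (ne , _ , _) → ne refl }
  }
  where
  flipG : ∀ {u v} → EqOrAdj G u v → EqOrAdj G v u
  flipG (inj₁ e) = inj₁ (sym e)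
  flipG (inj₂ a) = inj₂ (Adj-sym G a)
  flipH : ∀ {u v} → EqOrAdj H u v → EqOrAdj H v u
  flipH (inj₁ e) = inj₁ (sym e)
  flipH (inj₂ a) = inj₂ (Adj-sym H a)

module Game (G : Graph) (k : ℕ) where
  Cops : Set
  Cops = Fin k → V G

  Occupied : Cops → V G → Set
  Occupied C v = Σ (Fin k) λ i → C i ≡ v

  Surrounded : Cops → V G → Set
  Surrounded C r = ∀ v → Adj G r v → Occupied C v

  CopMove : Cops → Cops → Set
  CopMove C C' = ∀ i → EqOrAdj G (C i) (C' i)

  RobberMove : Cops → V G → V G → Set
  RobberMove C r r' = EqOrAdj G r r' × ¬ Occupied C r'

  -- Positions from which the cops can force a win (least fixed point, i.e.
  -- the cops have a strategy guaranteeing surrounding in finitely many moves).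
  mutual
    data CopsWinCopTurn : Cops → V G → Set where
      surrounded : ∀ {C r} → Surrounded C r → CopsWinCopTurn C r
      move       : ∀ {C r} C' → CopMove C C' → CopsWinRobberTurn C' r → CopsWinCopTurn C r

    data CopsWinRobberTurn : Cops → V G → Set where
      surrounded : ∀ {C r} → Surrounded C r → CopsWinRobberTurn C r
      allMoves   : ∀ {C r} → (∀ r' → RobberMove C r r' → CopsWinCopTurn C r') → CopsWinRobberTurn C r

  CopsWin : Set
  CopsWin = Σ Cops λ C₀ → ∀ r → ¬ Occupied C₀ r → CopsWinCopTurn C₀ r

SurroundingCopNumberIs : Graph → ℕ → Set
SurroundingCopNumberIs G k = Game.CopsWin G k × (∀ j → 1 ≤ j → j < k → ¬ Game.CopsWin G j)

module Submission where

-- Each cop strategy is a formation: a placement of the cops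
-- determined by the robber's position (on 3 × n boards, by a small state as
-- well) that follows every robber move with one cop move.  `Gathering` shows
-- that cops starting in a corner can always assemble the formation around the
-- robber, and `Trap` that a formation wins once every legal robber move
-- lowers a measure.  Five cops (on the robber and on his four "earlier"
-- neighbours) win on every board, four win on 2 × n and 3 × n boards, and
-- three on the 2 × 2 and 2 × 3 boards.
--
-- Lower bounds.  `Escape` shows, by pigeonhole, that the robber evades k cops
-- when he has good vertices, each with more than k distinct neighbours and
-- more than k distinct good vertices within one move.  Vertices with an
-- interior coordinate are good against four cops when m, n ≥ 4 and against
-- three cops when m = 3; interior columns are good against three cops on
-- 2 × n boards with n ≥ 4, and every vertex is good against two cops on 2 × n.

open import Defs
open import Data.Nat using (ℕ; zero; suc; pred; _+_; _*_; _∸_; _⊓_; _≤_; _<_; z≤n; s≤s; _<?_)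
open import Data.Nat.Properties
open import Data.Nat.Induction using (<-wellFounded)
open import Data.Fin as Fin using (Fin; zero; suc; toℕ; fromℕ<; inject₁; opposite)
open import Data.Fin.Properties
  using (toℕ-injective; toℕ-inject₁; toℕ-fromℕ<; toℕ<n; pigeonhole; any?; all?; ¬∀⟶∃¬)
  renaming (_≟_ to _≟ᶠ_)
open import Data.Product using (Σ; _×_; _,_; proj₁; proj₂; swap)
open import Data.Product.Properties using (≡-dec)
open import Data.Sum using (_⊎_; inj₁; inj₂; map₂)
import Data.Sum
open import Data.Unit using (⊤; tt)
open import Data.Empty using (⊥-elim)
open import Data.List using (List; []; _∷_; length; lookup; map)
open import Data.List.Properties using (length-map)
open import Data.List.Relation.Unary.All as All using (All; []; _∷_)
import Data.List.Relation.Unary.All.Properties as Allₚ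
open import Data.List.Relation.Unary.AllPairs using ([]; _∷_)
open import Data.List.Relation.Unary.Unique.Propositional using (Unique)
import Data.List.Relation.Unary.Unique.Propositional.Properties as Uniqueₚ
open import Data.List.Membership.Propositional.Properties using (∈-lookup)
open import Induction.WellFounded using (Acc; acc)
open import Relation.Nullary using (¬_; Dec; yes; no)
open import Relation.Nullary.Decidable using (_×-dec_)
open import Relation.Binary.Definitions using (DecidableEquality)
open import Relation.Binary.PropositionalEquality
  using (_≡_; refl; sym; trans; cong; cong₂; subst; subst₂)

Adjℕ : ℕ → ℕ → Set
Adjℕ a b = suc a ≡ b ⊎ suc b ≡ a

Near : ℕ → ℕ → Set
Near a b = a ≡ b ⊎ Adjℕ a b

near-sym : ∀ {a b} → Near a b → Near b a
near-sym (inj₁ e) = inj₁ (sym e)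
near-sym (inj₂ (inj₁ e)) = inj₂ (inj₂ e)
near-sym (inj₂ (inj₂ e)) = inj₂ (inj₁ e)

near-suc : ∀ {a b} → Near a b → Near (suc a) (suc b)
near-suc (inj₁ e) = inj₁ (cong suc e)
near-suc (inj₂ (inj₁ e)) = inj₂ (inj₁ (cong suc e))
near-suc (inj₂ (inj₂ e)) = inj₂ (inj₂ (cong suc e))

near-pred : ∀ {a b} → Near a b → Near (pred a) (pred b)
near-pred (inj₁ refl) = inj₁ refl
near-pred {zero} (inj₂ (inj₁ refl)) = inj₁ refl
near-pred {suc a} (inj₂ (inj₁ refl)) = inj₂ (inj₁ refl)
near-pred {b = zero} (inj₂ (inj₂ refl)) = inj₁ refl
near-pred {b = suc b} (inj₂ (inj₂ refl)) = inj₂ (inj₂ refl)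

near-⊓ : ∀ c {a b} → Near a b → Near (a ⊓ c) (b ⊓ c)
near-⊓ c (inj₁ refl) = inj₁ refl
near-⊓ zero {zero} (inj₂ (inj₁ refl)) = inj₁ refl
near-⊓ zero {suc a} (inj₂ (inj₁ refl)) = inj₁ refl
near-⊓ (suc c) {zero} (inj₂ (inj₁ refl)) = inj₂ (inj₁ refl)
near-⊓ (suc c) {suc a} (inj₂ (inj₁ refl)) = near-suc (near-⊓ c {a} (inj₂ (inj₁ refl)))
near-⊓ c {b = b} (inj₂ (inj₂ refl)) = near-sym (near-⊓ c {b} (inj₂ (inj₁ refl)))

near-≤ : ∀ {a b} → Near a b → a ≤ suc b
near-≤ (inj₁ refl) = n≤1+n _
near-≤ (inj₂ (inj₁ refl)) = m≤n⇒m≤1+n (n≤1+n _)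
near-≤ (inj₂ (inj₂ refl)) = ≤-refl

near-or-below : ∀ {a b} → a ≤ b → Near a b ⊎ suc a < b
near-or-below {zero} {zero} _ = inj₁ (inj₁ refl)
near-or-below {zero} {suc zero} _ = inj₁ (inj₂ (inj₁ refl))
near-or-below {zero} {suc (suc b)} _ = inj₂ (s≤s (s≤s z≤n))
near-or-below {suc a} {suc b} (s≤s a≤b) with near-or-below a≤b
... | inj₁ nr = inj₁ (near-suc nr)
... | inj₂ lt = inj₂ (s≤s lt)

adj-≢ : ∀ {a b} → Adjℕ a b → ¬ a ≡ b
adj-≢ (inj₁ e) refl = 1+n≢n e
adj-≢ (inj₂ e) refl = 1+n≢n e

ends-apart : ¬ EqOrAdj (Path 3) zero (suc (suc zero))
ends-apart (inj₁ ())
ends-apart (inj₂ (inj₁ ()))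
ends-apart (inj₂ (inj₂ ()))

ends-apart′ : ¬ EqOrAdj (Path 3) (suc (suc zero)) zero
ends-apart′ (inj₁ ())
ends-apart′ (inj₂ (inj₁ ()))
ends-apart′ (inj₂ (inj₂ ()))

toNear : ∀ {m} {i j : Fin m} → EqOrAdj (Path m) i j → Near (toℕ i) (toℕ j)
toNear (inj₁ refl) = inj₁ refl
toNear (inj₂ a) = inj₂ a

fromNear : ∀ {m} {i j : Fin m} → Near (toℕ i) (toℕ j) → EqOrAdj (Path m) i j
fromNear (inj₁ e) = inj₁ (toℕ-injective e)
fromNear (inj₂ a) = inj₂ a

-- Clamped unit steps along a path: `Fin.pred` steps towards the first vertex
-- and `up` towards the last one; each stays put at its end of the path.
up : ∀ {m} → Fin m → Fin m
up {suc m} i = fromℕ< {suc (toℕ i) ⊓ m} (s≤s (m⊓n≤n (suc (toℕ i)) m))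

toℕ-pred : ∀ {m} (i : Fin m) → toℕ (Fin.pred i) ≡ pred (toℕ i)
toℕ-pred zero = refl
toℕ-pred (suc i) = toℕ-inject₁ i

toℕ-up : ∀ {m} (i : Fin (suc m)) → toℕ (up i) ≡ suc (toℕ i) ⊓ m
toℕ-up {m} i = toℕ-fromℕ< (s≤s (m⊓n≤n (suc (toℕ i)) m))

up-step : ∀ {m} (i : Fin m) → suc (toℕ i) < m → toℕ (up i) ≡ suc (toℕ i)
up-step {suc m} i (s≤s lt) = trans (toℕ-up i) (m≤n⇒m⊓n≡m lt)

pred-near : ∀ {m} {i j : Fin m} → EqOrAdj (Path m) i j → EqOrAdj (Path m) (Fin.pred i) (Fin.pred j)
pred-near {i = i} {j} e = fromNear (subst₂ Near (sym (toℕ-pred i)) (sym (toℕ-pred j)) (near-pred (toNear e)))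

up-near : ∀ {m} {i j : Fin m} → EqOrAdj (Path m) i j → EqOrAdj (Path m) (up i) (up j)
up-near {suc m} {i} {j} e =
  fromNear (subst₂ Near (sym (toℕ-up i)) (sym (toℕ-up j)) (near-⊓ m (near-suc (toNear e))))

pred-near-self : ∀ {m} (i : Fin m) → EqOrAdj (Path m) (Fin.pred i) i
pred-near-self zero = inj₁ refl
pred-near-self (suc i) = inj₂ (inj₁ (cong suc (toℕ-inject₁ i)))

pred-hits : ∀ {m} {i j : Fin m} → suc (toℕ j) ≡ toℕ i → Fin.pred i ≡ j
pred-hits {i = i} e = toℕ-injective (trans (toℕ-pred i) (cong pred (sym e)))

up-hits : ∀ {m} {i j : Fin m} → suc (toℕ i) ≡ toℕ j → up i ≡ j
up-hits {m} {i} {j} e = toℕ-injective (trans (up-step i (subst (_< m) (sym e) (toℕ<n j))) e)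

-- The strong product of two paths is the king's graph on an m × n board.
King : ℕ → ℕ → Graph
King m n = Path m ⊠ Path n

king-move : ∀ {m n} {a a' : Fin m} {b b' : Fin n} →
  EqOrAdj (Path m) a a' → EqOrAdj (Path n) b b' → EqOrAdj (King m n) (a , b) (a' , b')
king-move {a = a} {a'} {b} {b'} ea eb with ≡-dec _≟ᶠ_ _≟ᶠ_ (a , b) (a' , b')
... | yes e = inj₁ e
... | no ne = inj₂ (ne , ea , eb)

row-move : ∀ {m n} {p q : Fin m × Fin n} → EqOrAdj (King m n) p q → EqOrAdj (Path m) (proj₁ p) (proj₁ q)
row-move (inj₁ refl) = inj₁ refl
row-move (inj₂ (_ , a , _)) = a

col-move : ∀ {m n} {p q : Fin m × Fin n} → EqOrAdj (King m n) p q → EqOrAdj (Path n) (proj₂ p) (proj₂ q)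
col-move (inj₁ refl) = inj₁ refl
col-move (inj₂ (_ , _ , b)) = b

-- One step of an index `a` towards a target `t` (staying put on the target).
stepℕ : ℕ → ℕ → ℕ
stepℕ zero zero = zero
stepℕ zero (suc t) = 1
stepℕ (suc a) zero = a
stepℕ (suc a) (suc t) = suc (stepℕ a t)

stepF : ∀ {m} → Fin m → Fin m → Fin m
stepF zero zero = zero
stepF {suc (suc m)} zero (suc t) = suc zero
stepF (suc a) zero = inject₁ a
stepF (suc a) (suc t) = suc (stepF a t)

toℕ-stepF : ∀ {m} (a t : Fin m) → toℕ (stepF a t) ≡ stepℕ (toℕ a) (toℕ t)
toℕ-stepF zero zero = refl
toℕ-stepF {suc (suc m)} zero (suc t) = refl
toℕ-stepF (suc a) zero = toℕ-inject₁ a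
toℕ-stepF (suc a) (suc t) = cong suc (toℕ-stepF a t)

step-near : ∀ a t → Near a (stepℕ a t)
step-near zero zero = inj₁ refl
step-near zero (suc t) = inj₂ (inj₁ refl)
step-near (suc a) zero = inj₂ (inj₂ refl)
step-near (suc a) (suc t) = near-suc (step-near a t)

step-ahead : ∀ a t → a < t → stepℕ a t ≡ suc a
step-ahead zero (suc t) _ = refl
step-ahead (suc a) (suc t) (s≤s lt) = cong suc (step-ahead a t lt)

step-onto : ∀ a t → Near a t → stepℕ a t ≡ t
step-onto a t (inj₁ refl) = on-target a
  where
  on-target : ∀ a → stepℕ a a ≡ a
  on-target zero = refl
  on-target (suc a) = cong suc (on-target a)
step-onto a t (inj₂ (inj₁ refl)) = step-ahead a (suc a) ≤-refl
step-onto a t (inj₂ (inj₂ refl)) = from-above t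
  where
  from-above : ∀ t → stepℕ (suc t) t ≡ t
  from-above zero = refl
  from-above (suc t) = cong suc (from-above t)

-- A cop index `a` chasing a target index `t` on a path of length M, with `f`
-- rounds to go: it is near the target, or two or more below it and still able
-- to climb for f rounds (a + f ≥ M), so it is near when f runs out.
Chasing : ℕ → ℕ → ℕ → ℕ → Set
Chasing M f a t = Near a t ⊎ (suc a < t × M ≤ a + f)

chasing-start : ∀ {M f} → M ≤ f → ∀ t → Chasing M f 0 t
chasing-start M≤f t with near-or-below (z≤n {t})
... | inj₁ nr = inj₁ nr
... | inj₂ lt = inj₂ (lt , M≤f)

chasing-step : ∀ {M f a t t'} → Chasing M (suc f) a t → Near t t' → Chasing M f (stepℕ a t) t'
chasing-step {a = a} {t} (inj₁ nr) tt' rewrite step-onto a t nr = inj₁ tt'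
chasing-step {M} {f} {a} {t} {t'} (inj₂ (lt , bound)) tt'
  rewrite step-ahead a t (<-trans (n<1+n a) lt) =
  map₂ (_, subst (M ≤_) (+-suc a f) bound) (near-or-below (≤-pred (≤-trans lt (near-≤ tt'))))

chasing-end : ∀ {M a t} → t < M → Chasing M 0 a t → Near a t
chasing-end t<M (inj₁ nr) = nr
chasing-end {a = a} t<M (inj₂ (lt , bound)) =
  ⊥-elim (<-irrefl refl (≤-trans (<-trans (<-trans (n<1+n a) lt) t<M) (subst (_ ≤_) (+-identityʳ a) bound)))

-- Suppose every robber position r prescribes a formation T r of
-- the cops that moves by at most one step per cop when the robber moves, and
-- from which the cops win with the robber to move.  Then the cops win: they all
-- start in a corner and every cop steps, coordinate by coordinate, towards its
-- place in the current formation; after as many rounds as there are rows plus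
-- columns every cop is at most one step from its place, and one more move
-- completes the formation.
module Gathering (m n k : ℕ)
  (T : Fin (suc m) × Fin (suc n) → Game.Cops (King (suc m) (suc n)) k)
  (T-near : ∀ {r r'} → EqOrAdj (King (suc m) (suc n)) r r' → ∀ i → EqOrAdj (King (suc m) (suc n)) (T r i) (T r' i))
  (T-wins : ∀ r → Game.CopsWinRobberTurn (King (suc m) (suc n)) k (T r) r) where
  open Game (King (suc m) (suc n)) k

  row col : Fin (suc m) × Fin (suc n) → ℕ
  row p = toℕ (proj₁ p)
  col p = toℕ (proj₂ p)

  Tracking : ℕ → Cops → Fin (suc m) × Fin (suc n) → Set
  Tracking f C r = ∀ i → Chasing (suc m) f (row (C i)) (row (T r i)) × Chasing (suc n) f (col (C i)) (col (T r i))

  approach : Cops → Fin (suc m) × Fin (suc n) → Cops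
  approach C r i = stepF (proj₁ (C i)) (proj₁ (T r i)) , stepF (proj₂ (C i)) (proj₂ (T r i))

  approach-move : ∀ C r → CopMove C (approach C r)
  approach-move C r i = king-move (step-move (proj₁ (C i)) (proj₁ (T r i))) (step-move (proj₂ (C i)) (proj₂ (T r i)))
    where
    step-move : ∀ {M} (a t : Fin M) → EqOrAdj (Path M) a (stepF a t)
    step-move a t = fromNear (subst (Near (toℕ a)) (sym (toℕ-stepF a t)) (step-near (toℕ a) (toℕ t)))

  tracking-step : ∀ {f C r r'} → Tracking (suc f) C r → EqOrAdj (King (suc m) (suc n)) r r' → Tracking f (approach C r) r'
  tracking-step {C = C} {r} tr e i =
    chase (proj₁ (C i)) (proj₁ (T r i)) (proj₁ (tr i)) (row-move (T-near e i)) ,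
    chase (proj₂ (C i)) (proj₂ (T r i)) (proj₂ (tr i)) (col-move (T-near e i))
    where
    chase : ∀ {M f} (a t : Fin M) {t' : Fin M} → Chasing M (suc f) (toℕ a) (toℕ t) → EqOrAdj (Path M) t t' →
            Chasing M f (toℕ (stepF a t)) (toℕ t')
    chase {M} {f} a t {t'} ch tt' =
      subst (λ s → Chasing M f s (toℕ t')) (sym (toℕ-stepF a t)) (chasing-step ch (toNear tt'))

  gather : ∀ f C r → Tracking f C r → CopsWinCopTurn C r
  gather zero C r tr = move (T r) complete (T-wins r)
    where
    complete : CopMove C (T r)
    complete i = king-move (fromNear (chasing-end (toℕ<n (proj₁ (T r i))) (proj₁ (tr i))))
                           (fromNear (chasing-end (toℕ<n (proj₂ (T r i))) (proj₂ (tr i))))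
  gather (suc f) C r tr = move (approach C r) (approach-move C r)
    (allMoves λ r' mv → gather f (approach C r) r' (tracking-step tr (proj₁ mv)))

  copsWin : CopsWin
  copsWin = corner , λ r _ → gather (suc m + suc n) corner r (start r)
    where
    corner : Cops
    corner _ = zero , zero
    start : ∀ r → Tracking (suc m + suc n) corner r
    start r i = chasing-start (m≤m+n (suc m) (suc n)) _ , chasing-start (m≤n+m (suc n) (suc m)) _

module Trap {G : Graph} {k : ℕ} {S : Set} (pos : S → V G) (T : S → Game.Cops G k) (μ : S → ℕ) where
  open Game G k

  Answer : S → V G → Set
  Answer s r' = Σ S λ s' → pos s' ≡ r' × CopMove (T s) (T s') × μ s' < μ s

  Trapping : Set
  Trapping = ∀ s → Surrounded (T s) (pos s) ⊎ (∀ r' → RobberMove (T s) (pos s) r' → Answer s r')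

  trap-wins : Trapping → ∀ s → CopsWinRobberTurn (T s) (pos s)
  trap-wins trapping s = go s (<-wellFounded (μ s))
    where
    go : ∀ s → Acc _<_ (μ s) → CopsWinRobberTurn (T s) (pos s)
    go s (acc smaller) with trapping s
    ... | inj₁ surrounded-now = surrounded surrounded-now
    ... | inj₂ answer = allMoves λ r' mv → respond r' (answer r' mv)
      where
      respond : ∀ r' → Answer s r' → CopsWinCopTurn (T s) r'
      respond r' (s' , refl , cm , lt) = move (T s') cm (go s' (smaller lt))

data Shift : Set where
  back stay ahead : Shift

shift : ∀ {m} → Shift → Fin m → Fin m
shift back = Fin.pred
shift stay i = i
shift ahead = up

shift-near : ∀ {m} (s : Shift) {i j : Fin m} → EqOrAdj (Path m) i j → EqOrAdj (Path m) (shift s i) (shift s j)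
shift-near back = pred-near
shift-near stay e = e
shift-near ahead = up-near

offsets : ∀ {m n k} → (Fin k → Shift) → (Fin k → Shift) → Fin m × Fin n → Fin k → Fin m × Fin n
offsets ρ κ (x , y) i = shift (ρ i) x , shift (κ i) y

offsets-near : ∀ {m n k} (ρ κ : Fin k → Shift) {r r' : Fin m × Fin n} →
  EqOrAdj (King m n) r r' → ∀ i → EqOrAdj (King m n) (offsets ρ κ r i) (offsets ρ κ r' i)
offsets-near ρ κ e i = king-move (shift-near (ρ i) (row-move e)) (shift-near (κ i) (col-move e))

-- A lexicographic measure: a primary index a < M that may only increase,
-- refined by a secondary rank k < K.
lex : ℕ → ℕ → ℕ → ℕ → ℕ
lex M K a k = (M ∸ suc a) * K + k

lex-advance : ∀ {M K a a' k k'} → suc a ≡ a' → a' < M → k' < K → lex M K a' k' < lex M K a k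
lex-advance {M} {K} {a} {a'} {k} {k'} refl a'<M k'<K = begin-strict
  (M ∸ suc a') * K + k'      <⟨ +-monoʳ-< ((M ∸ suc a') * K) k'<K ⟩
  (M ∸ suc a') * K + K       ≡⟨ +-comm ((M ∸ suc a') * K) K ⟩
  suc (M ∸ suc a') * K       ≡⟨ cong (_* K) (sym (∸-split M a' a'<M)) ⟩
  (M ∸ a') * K               ≤⟨ m≤m+n ((M ∸ a') * K) k ⟩
  (M ∸ a') * K + k           ∎
  where
  open ≤-Reasoning
  ∸-split : ∀ M a → a < M → M ∸ a ≡ suc (M ∸ suc a)
  ∸-split (suc M) zero _ = refl
  ∸-split (suc M) (suc a) (s≤s lt) = ∸-split M a lt

lex-refine : ∀ M K a {k k'} → k' < k → lex M K a k' < lex M K a k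
lex-refine M K a = +-monoʳ-< ((M ∸ suc a) * K)

-- The number of cells after (a , c) in row-major order on an M × N board;
-- it drops whenever the position moves to a later row or along its row.
cellsAfter : ∀ {M N} → Fin M × Fin N → ℕ
cellsAfter {M} {N} (a , c) = lex M N (toℕ a) (N ∸ suc (toℕ c))

cellsAfter-next-row : ∀ {M N} {a a' : Fin M} (c c' : Fin N) → suc (toℕ a) ≡ toℕ a' →
  cellsAfter (a' , c') < cellsAfter (a , c)
cellsAfter-next-row {N = suc N} {a' = a'} c c' e = lex-advance e (toℕ<n a') (s≤s (m∸n≤m N (toℕ c')))

cellsAfter-next-col : ∀ {M N} (a : Fin M) {c c' : Fin N} → suc (toℕ c) ≡ toℕ c' →
  cellsAfter (a , c') < cellsAfter (a , c)
cellsAfter-next-col {M} {N} a {c' = c'} e = lex-refine M N (toℕ a) (∸-monoʳ-< (s≤s (≤-reflexive e)) (toℕ<n c'))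

-- Five cops suffice on every king's graph: one cop on the robber and four on
-- the neighbours (x-1,y-1), (x-1,y), (x-1,y+1), (x,y-1).  Every legal robber
-- move goes to a later cell in row-major order, so he is soon stuck.
module FiveCops (m n : ℕ) where
  open Game (King (suc m) (suc n)) 5

  ρ κ : Fin 5 → Shift
  ρ zero = back
  ρ (suc zero) = back
  ρ (suc (suc zero)) = back
  ρ (suc (suc (suc zero))) = stay
  ρ (suc (suc (suc (suc zero)))) = stay
  κ zero = back
  κ (suc zero) = stay
  κ (suc (suc zero)) = ahead
  κ (suc (suc (suc zero))) = back
  κ (suc (suc (suc (suc zero)))) = stay

  formation : Fin (suc m) × Fin (suc n) → Cops
  formation = offsets ρ κ

  -- every vertex before the robber in row-major order and within reach is occupied
  forward : ∀ r r' → RobberMove (formation r) r r' → cellsAfter r' < cellsAfter r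
  forward (x , y) (x' , y') (e , free) with row-move e | col-move e
  ... | inj₁ refl | inj₁ refl = ⊥-elim (free (suc (suc (suc (suc zero))) , refl))
  ... | inj₁ refl | inj₂ (inj₁ ey) = cellsAfter-next-col x ey
  ... | inj₁ refl | inj₂ (inj₂ ey) = ⊥-elim (free (suc (suc (suc zero)) , cong (x ,_) (pred-hits ey)))
  ... | inj₂ (inj₁ ex) | _ = cellsAfter-next-row y y' ex
  ... | inj₂ (inj₂ ex) | inj₁ refl = ⊥-elim (free (suc zero , cong (_, y) (pred-hits ex)))
  ... | inj₂ (inj₂ ex) | inj₂ (inj₁ ey) = ⊥-elim (free (suc (suc zero) , cong₂ _,_ (pred-hits ex) (up-hits ey)))
  ... | inj₂ (inj₂ ex) | inj₂ (inj₂ ey) = ⊥-elim (free (zero , cong₂ _,_ (pred-hits ex) (pred-hits ey)))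

  open Trap {King (suc m) (suc n)} {5} (λ r → r) formation cellsAfter

  trapping : Trapping
  trapping r = inj₂ λ r' mv → r' , refl , offsets-near ρ κ (proj₁ mv) , forward r r' mv

  copsWin : CopsWin
  copsWin = Gathering.copsWin m n 5 formation (offsets-near ρ κ) (trap-wins trapping)

-- Four cops suffice on a 2 × n board: two guard the column behind the robber,
-- one stands on him and one on the first row of his column.  Every legal
-- robber move goes to a later cell in column-major order.
module TwoRows (n : ℕ) where
  open Game (King 2 (suc n)) 4

  ρ κ : Fin 4 → Shift
  ρ zero = back
  ρ (suc zero) = ahead
  ρ (suc (suc zero)) = back
  ρ (suc (suc (suc zero))) = stay
  κ zero = back
  κ (suc zero) = back
  κ (suc (suc zero)) = stay
  κ (suc (suc (suc zero))) = stay

  formation : Fin 2 × Fin (suc n) → Cops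
  formation = offsets ρ κ

  -- column-major order is row-major order on the transposed board
  cellsAfterᵀ : Fin 2 × Fin (suc n) → ℕ
  cellsAfterᵀ (x , y) = cellsAfter (y , x)

  -- the column behind the robber is held, and within his column he can only
  -- move from the first row to the second
  forward : ∀ r r' → RobberMove (formation r) r r' → cellsAfterᵀ r' < cellsAfterᵀ r
  forward (x , y) (x' , y') (e , free) with col-move e | row-move e
  ... | inj₂ (inj₁ ey) | _ = cellsAfter-next-row x x' ey
  ... | inj₁ refl | inj₁ refl = ⊥-elim (free (suc (suc (suc zero)) , refl))
  ... | inj₁ refl | inj₂ (inj₁ ex) = cellsAfter-next-col y ex
  ... | inj₁ refl | inj₂ (inj₂ ex) = ⊥-elim (free (suc (suc zero) , cong (_, y) (pred-hits ex)))
  forward (zero , y) (zero , y') (e , free) | inj₂ (inj₂ ey) | _ = ⊥-elim (free (zero , cong (zero ,_) (pred-hits ey)))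
  forward (suc zero , y) (zero , y') (e , free) | inj₂ (inj₂ ey) | _ = ⊥-elim (free (zero , cong (zero ,_) (pred-hits ey)))
  forward (zero , y) (suc zero , y') (e , free) | inj₂ (inj₂ ey) | _ = ⊥-elim (free (suc zero , cong (suc zero ,_) (pred-hits ey)))
  forward (suc zero , y) (suc zero , y') (e , free) | inj₂ (inj₂ ey) | _ = ⊥-elim (free (suc zero , cong (suc zero ,_) (pred-hits ey)))

  open Trap {King 2 (suc n)} {4} (λ r → r) formation cellsAfterᵀ

  trapping : Trapping
  trapping r = inj₂ λ r' mv → r' , refl , offsets-near ρ κ (proj₁ mv) , forward r r' mv

  copsWin : CopsWin
  copsWin = Gathering.copsWin 1 n 4 formation (offsets-near ρ κ) (trap-wins trapping)

-- In a chase state three cops form a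
-- wall on the column behind the robber and the fourth (his shadow) stands on
-- him.  When the robber leaves the middle row inside his column he enters a
-- corner state: the wall cop of the opposite side row steps into the middle of
-- his column, so his only moves advance a column.  Every robber move either
-- advances a column or lowers the rank (chase on a side row 2, chase on the
-- middle row 1, corner 0) within his column.
module ThreeRows (n : ℕ) where
  open Game (King 3 (suc n)) 4

  data Side : Set where
    low high : Side

  middle : Fin 3
  middle = suc zero

  sideRow : Side → Fin 3
  sideRow low = zero
  sideRow high = suc (suc zero)

  data State : Set where
    chase : Fin 3 → Fin (suc n) → State
    corner : Side → Fin (suc n) → State

  pos : State → Fin 3 × Fin (suc n)
  pos (chase x y) = x , y
  pos (corner s y) = sideRow s , y

  shadow : Fin 4
  shadow = suc (suc (suc zero))

  formation : State → Cops
  formation (chase x y) zero = zero , Fin.pred y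
  formation (chase x y) (suc zero) = middle , Fin.pred y
  formation (chase x y) (suc (suc zero)) = suc (suc zero) , Fin.pred y
  formation (chase x y) (suc (suc (suc zero))) = x , y
  formation (corner low y) zero = zero , Fin.pred y
  formation (corner low y) (suc zero) = middle , Fin.pred y
  formation (corner low y) (suc (suc zero)) = middle , y
  formation (corner low y) (suc (suc (suc zero))) = zero , y
  formation (corner high y) zero = middle , y
  formation (corner high y) (suc zero) = middle , Fin.pred y
  formation (corner high y) (suc (suc zero)) = suc (suc zero) , Fin.pred y
  formation (corner high y) (suc (suc (suc zero))) = suc (suc zero) , y

  rank : State → ℕ
  rank (chase zero _) = 2
  rank (chase (suc zero) _) = 1
  rank (chase (suc (suc zero)) _) = 2
  rank (corner _ _) = 0

  rank<3 : ∀ s → rank s < 3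
  rank<3 (chase zero _) = s≤s (s≤s (s≤s z≤n))
  rank<3 (chase (suc zero) _) = s≤s (s≤s z≤n)
  rank<3 (chase (suc (suc zero)) _) = s≤s (s≤s (s≤s z≤n))
  rank<3 (corner _ _) = s≤s z≤n

  measure : State → ℕ
  measure s = lex (suc n) 3 (toℕ (proj₂ (pos s))) (rank s)

  chase-follows : ∀ {x y x' y'} → EqOrAdj (King 3 (suc n)) (x , y) (x' , y') →
    CopMove (formation (chase x y)) (formation (chase x' y'))
  chase-follows e zero = king-move (inj₁ refl) (pred-near (col-move e))
  chase-follows e (suc zero) = king-move (inj₁ refl) (pred-near (col-move e))
  chase-follows e (suc (suc zero)) = king-move (inj₁ refl) (pred-near (col-move e))
  chase-follows e (suc (suc (suc zero))) = e

  enter-corner : ∀ s y → CopMove (formation (chase middle y)) (formation (corner s y))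
  enter-corner low y zero = inj₁ refl
  enter-corner low y (suc zero) = inj₁ refl
  enter-corner low y (suc (suc zero)) = king-move (inj₂ (inj₂ refl)) (pred-near-self y)
  enter-corner low y (suc (suc (suc zero))) = king-move (inj₂ (inj₂ refl)) (inj₁ refl)
  enter-corner high y zero = king-move (inj₂ (inj₁ refl)) (pred-near-self y)
  enter-corner high y (suc zero) = inj₁ refl
  enter-corner high y (suc (suc zero)) = inj₁ refl
  enter-corner high y (suc (suc (suc zero))) = king-move (inj₂ (inj₁ refl)) (inj₁ refl)

  leave-corner : ∀ s {y x' y'} → EqOrAdj (King 3 (suc n)) (sideRow s , y) (x' , y') → suc (toℕ y) ≡ toℕ y' →
    CopMove (formation (corner s y)) (formation (chase x' y'))
  leave-corner low e advance zero = king-move (inj₁ refl) (pred-near (col-move e))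
  leave-corner low e advance (suc zero) = king-move (inj₁ refl) (pred-near (col-move e))
  leave-corner low e advance (suc (suc zero)) = king-move (inj₂ (inj₁ refl)) (inj₁ (sym (pred-hits advance)))
  leave-corner low e advance (suc (suc (suc zero))) = e
  leave-corner high e advance zero = king-move (inj₂ (inj₂ refl)) (inj₁ (sym (pred-hits advance)))
  leave-corner high e advance (suc zero) = king-move (inj₁ refl) (pred-near (col-move e))
  leave-corner high e advance (suc (suc zero)) = king-move (inj₁ refl) (pred-near (col-move e))
  leave-corner high e advance (suc (suc (suc zero))) = e

  chase-behind : ∀ x y x' {y'} → suc (toℕ y') ≡ toℕ y → Occupied (formation (chase x y)) (x' , y')
  chase-behind x y zero down = zero , cong (zero ,_) (pred-hits down)
  chase-behind x y (suc zero) down = suc zero , cong (middle ,_) (pred-hits down)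
  chase-behind x y (suc (suc zero)) down = suc (suc zero) , cong (suc (suc zero) ,_) (pred-hits down)

  corner-behind : ∀ s y {x' y'} → EqOrAdj (Path 3) (sideRow s) x' → suc (toℕ y') ≡ toℕ y →
    Occupied (formation (corner s y)) (x' , y')
  corner-behind low y {zero} _ down = zero , cong (zero ,_) (pred-hits down)
  corner-behind low y {suc zero} _ down = suc zero , cong (middle ,_) (pred-hits down)
  corner-behind low y {suc (suc zero)} e _ = ⊥-elim (ends-apart e)
  corner-behind high y {zero} e _ = ⊥-elim (ends-apart′ e)
  corner-behind high y {suc zero} _ down = suc zero , cong (middle ,_) (pred-hits down)
  corner-behind high y {suc (suc zero)} _ down = suc (suc zero) , cong (suc (suc zero) ,_) (pred-hits down)

  corner-column : ∀ s y {x'} → EqOrAdj (Path 3) (sideRow s) x' → Occupied (formation (corner s y)) (x' , y)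
  corner-column low y {zero} _ = shadow , refl
  corner-column low y {suc zero} _ = suc (suc zero) , refl
  corner-column low y {suc (suc zero)} e = ⊥-elim (ends-apart e)
  corner-column high y {zero} e = ⊥-elim (ends-apart′ e)
  corner-column high y {suc zero} _ = zero , refl
  corner-column high y {suc (suc zero)} _ = shadow , refl

  open Trap {King 3 (suc n)} {4} pos formation measure

  sideways : ∀ x x' y → EqOrAdj (King 3 (suc n)) (x , y) (x' , y) →
    ¬ Occupied (formation (chase x y)) (x' , y) → Answer (chase x y) (x' , y)
  sideways zero zero y _ free = ⊥-elim (free (shadow , refl))
  sideways zero (suc zero) y e _ = chase middle y , refl , chase-follows e , lex-refine (suc n) 3 (toℕ y) (s≤s (s≤s z≤n))
  sideways zero (suc (suc zero)) y e _ = ⊥-elim (ends-apart (row-move e))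
  sideways (suc zero) zero y _ _ = corner low y , refl , enter-corner low y , lex-refine (suc n) 3 (toℕ y) (s≤s z≤n)
  sideways (suc zero) (suc zero) y _ free = ⊥-elim (free (shadow , refl))
  sideways (suc zero) (suc (suc zero)) y _ _ = corner high y , refl , enter-corner high y , lex-refine (suc n) 3 (toℕ y) (s≤s z≤n)
  sideways (suc (suc zero)) zero y e _ = ⊥-elim (ends-apart′ (row-move e))
  sideways (suc (suc zero)) (suc zero) y e _ = chase middle y , refl , chase-follows e , lex-refine (suc n) 3 (toℕ y) (s≤s (s≤s z≤n))
  sideways (suc (suc zero)) (suc (suc zero)) y _ free = ⊥-elim (free (shadow , refl))

  trapping : Trapping
  trapping (chase x y) = inj₂ answer
    where
    answer : ∀ r' → RobberMove (formation (chase x y)) (x , y) r' → Answer (chase x y) r'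
    answer (x' , y') (e , free) with col-move e
    ... | inj₁ refl = sideways x x' y e free
    ... | inj₂ (inj₁ advance) = chase x' y' , refl , chase-follows e , lex-advance advance (toℕ<n y') (rank<3 (chase x' y'))
    ... | inj₂ (inj₂ down) = ⊥-elim (free (chase-behind x y x' down))
  trapping (corner s y) = inj₂ answer
    where
    answer : ∀ r' → RobberMove (formation (corner s y)) (sideRow s , y) r' → Answer (corner s y) r'
    answer (x' , y') (e , free) with col-move e
    ... | inj₁ refl = ⊥-elim (free (corner-column s y (row-move e)))
    ... | inj₂ (inj₁ advance) = chase x' y' , refl , leave-corner s e advance , lex-advance advance (toℕ<n y') (rank<3 (chase x' y'))
    ... | inj₂ (inj₂ down) = ⊥-elim (free (corner-behind s y (row-move e) down))

  copsWin : CopsWin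
  copsWin = Gathering.copsWin 2 n 4 (λ r → formation (chase (proj₁ r) (proj₂ r))) chase-follows
    (λ r → trap-wins trapping (chase (proj₁ r) (proj₂ r)))

two-near : ∀ (a b : Fin 2) → EqOrAdj (Path 2) a b
two-near zero zero = inj₁ refl
two-near zero (suc zero) = inj₂ (inj₁ refl)
two-near (suc zero) zero = inj₂ (inj₂ refl)
two-near (suc zero) (suc zero) = inj₁ refl

same-or-opposite : ∀ (a b : Fin 2) → a ≡ b ⊎ opposite a ≡ b
same-or-opposite zero zero = inj₁ refl
same-or-opposite zero (suc zero) = inj₂ refl
same-or-opposite (suc zero) zero = inj₂ refl
same-or-opposite (suc zero) (suc zero) = inj₁ refl

-- Three cops suffice on the 2 × 2 board: they occupy the three vertices other
-- than the robber's, so he is always surrounded.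
module TwoByTwo where
  open Game (King 2 2) 3

  formation : Fin 2 × Fin 2 → Cops
  formation (x , y) zero = opposite x , y
  formation (x , y) (suc zero) = x , opposite y
  formation (x , y) (suc (suc zero)) = opposite x , opposite y

  always-surrounded : ∀ r → Surrounded (formation r) r
  always-surrounded (x , y) (x' , y') (ne , _) with same-or-opposite x x' | same-or-opposite y y'
  ... | inj₁ refl | inj₁ refl = ⊥-elim (ne refl)
  ... | inj₂ ex | inj₁ refl = zero , cong (_, y) ex
  ... | inj₁ refl | inj₂ ey = suc zero , cong (x ,_) ey
  ... | inj₂ ex | inj₂ ey = suc (suc zero) , cong₂ _,_ ex ey

  copsWin : CopsWin
  copsWin = Gathering.copsWin 1 1 3 formation (λ _ i → king-move (two-near _ _) (two-near _ _))
    (λ r → surrounded (always-surrounded r))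

-- Three cops suffice on the 2 × 3 board: two hold the centre column and the
-- third stands on the other vertex of the robber's column.  On a side column
-- the robber is surrounded; on the centre column he must step to a side column.
module TwoByThree where
  open Game (King 2 3) 3

  centre : Fin 3
  centre = suc zero

  formation : Fin 2 × Fin 3 → Cops
  formation (x , y) zero = opposite x , y
  formation (x , y) (suc zero) = opposite x , centre
  formation (x , y) (suc (suc zero)) = x , centre

  follows : ∀ {r r'} → EqOrAdj (King 2 3) r r' → CopMove (formation r) (formation r')
  follows e zero = king-move (two-near _ _) (col-move e)
  follows e (suc zero) = king-move (two-near _ _) (inj₁ refl)
  follows e (suc (suc zero)) = king-move (two-near _ _) (inj₁ refl)

  centre-held : ∀ x y x' → Occupied (formation (x , y)) (x' , centre)
  centre-held x y x' with same-or-opposite x x'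
  ... | inj₁ refl = suc (suc zero) , refl
  ... | inj₂ e = suc zero , cong (_, centre) e

  column-held : ∀ x y x' → ¬ x ≡ x' → Occupied (formation (x , y)) (x' , y)
  column-held x y x' ne with same-or-opposite x x'
  ... | inj₁ e = ⊥-elim (ne e)
  ... | inj₂ e = zero , cong (_, y) e

  side-surrounded : ∀ x y → ¬ y ≡ centre → Surrounded (formation (x , y)) (x , y)
  side-surrounded x y _ (x' , suc zero) _ = centre-held x y x'
  side-surrounded x zero _ (x' , zero) (ne , _) = column-held x zero x' λ { refl → ne refl }
  side-surrounded x (suc (suc zero)) _ (x' , suc (suc zero)) (ne , _) = column-held x _ x' λ { refl → ne refl }
  side-surrounded x zero _ (x' , suc (suc zero)) (_ , _ , far) = ⊥-elim (ends-apart far)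
  side-surrounded x (suc (suc zero)) _ (x' , zero) (_ , _ , far) = ⊥-elim (ends-apart′ far)
  side-surrounded x (suc zero) side _ _ = ⊥-elim (side refl)

  wins : ∀ r → CopsWinRobberTurn (formation r) r
  wins (x , zero) = surrounded (side-surrounded x zero λ ())
  wins (x , suc (suc zero)) = surrounded (side-surrounded x (suc (suc zero)) λ ())
  wins (x , suc zero) = allMoves to-side
    where
    to-side : ∀ r' → RobberMove (formation (x , centre)) (x , centre) r' → CopsWinCopTurn (formation (x , centre)) r'
    to-side (x' , suc zero) (_ , free) = ⊥-elim (free (centre-held x centre x'))
    to-side (x' , zero) (e , _) = move (formation (x' , zero)) (follows e) (surrounded (side-surrounded x' zero λ ()))
    to-side (x' , suc (suc zero)) (e , _) =
      move (formation (x' , suc (suc zero))) (follows e) (surrounded (side-surrounded x' (suc (suc zero)) λ ()))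

  copsWin : CopsWin
  copsWin = Gathering.copsWin 1 2 3 formation follows wins

Spread : ∀ {A : Set} → ℕ → (A → Set) → Set
Spread {A} c P = Σ (List A) λ xs → c ≤ length xs × Unique xs × All P xs

spread-weaken : ∀ {A : Set} {P : A → Set} {c c'} → c' ≤ c → Spread c P → Spread c' P
spread-weaken c'≤c (xs , c≤ , u , ps) = xs , ≤-trans c'≤c c≤ , u , ps

spread-map : ∀ {A B : Set} {P : A → Set} {Q : B → Set} {c} (f : A → B) →
  (∀ {a a'} → f a ≡ f a' → a ≡ a') → (∀ {a} → P a → Q (f a)) → Spread c P → Spread c Q
spread-map {c = c} f inj pq (xs , c≤ , u , ps) =
  map f xs , subst (c ≤_) (sym (length-map f xs)) c≤ , Uniqueₚ.map⁺ inj u , Allₚ.map⁺ (All.map pq ps)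

lookup-injective : ∀ {A : Set} {xs : List A} → Unique xs → ∀ i j → lookup xs i ≡ lookup xs j → i ≡ j
lookup-injective (_ ∷ _) zero zero _ = refl
lookup-injective (fresh ∷ _) zero (suc j) e = ⊥-elim (All.lookup fresh (∈-lookup j) e)
lookup-injective (fresh ∷ _) (suc i) zero e = ⊥-elim (All.lookup fresh (∈-lookup i) (sym e))
lookup-injective (_ ∷ u) (suc i) (suc j) e = cong suc (lookup-injective u i j e)

-- Suppose the robber has a set of good vertices such that every good
-- vertex has more than k distinct neighbours and more than k distinct good
-- vertices within one move.  By pigeonhole k cops never occupy all of either,
-- so from a good vertex he is never surrounded and can always move to a good
-- vertex free of cops; hence he evades k cops forever.
module Escape {G : Graph} (_≟_ : DecidableEquality (V G)) (k : ℕ) where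
  open Game G k

  occupied? : ∀ C v → Dec (Occupied C v)
  occupied? C v = any? (λ i → C i ≟ v)

  free-in : ∀ C {P} → Spread (suc k) P → Σ (V G) λ v → P v × ¬ Occupied C v
  free-in C (xs , k<len , u , ps) with all? (λ i → occupied? C (lookup xs i))
  ... | no not-all with ¬∀⟶∃¬ _ _ (λ i → occupied? C (lookup xs i)) not-all
  ...   | i , free = lookup xs i , All.lookup ps (∈-lookup i) , free
  free-in C (xs , k<len , u , ps) | yes all with pigeonhole k<len (λ i → proj₁ (all i))
  ...   | i , j , i<j , same-cop = ⊥-elim (<-irrefl (cong toℕ (lookup-injective u i j same-vertex)) i<j)
    where
    same-vertex : lookup xs i ≡ lookup xs j
    same-vertex = trans (sym (proj₂ (all i))) (trans (cong C same-cop) (proj₂ (all j)))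

  module _ (Good : V G → Set)
    (neighbours : ∀ r → Good r → Spread (suc k) (Adj G r))
    (moves : ∀ r → Good r → Spread (suc k) (λ v → EqOrAdj G r v × Good v)) where

    not-surrounded : ∀ C r → Good r → ¬ Surrounded C r
    not-surrounded C r g s with free-in C (neighbours r g)
    ... | v , adj , free = free (s v adj)

    mutual
      evades-cop-turn : ∀ C r → Good r → ¬ CopsWinCopTurn C r
      evades-cop-turn C r g (surrounded s) = not-surrounded C r g s
      evades-cop-turn C r g (move C' _ w) = evades-robber-turn C' r g w

      evades-robber-turn : ∀ C r → Good r → ¬ CopsWinRobberTurn C r
      evades-robber-turn C r g (surrounded s) = not-surrounded C r g s
      evades-robber-turn C r g (allMoves w) with free-in C (moves r g)
      ... | v , (e , g') , free = evades-cop-turn C v g' (w v (e , free))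

    robberWins : Σ (V G) Good → ¬ CopsWin
    robberWins (r , g) (C₀ , w) with free-in C₀ (moves r g)
    ... | v , (_ , g') , free = evades-cop-turn C₀ v g' (w v free)

Interior : ∀ {m} → Fin m → Set
Interior {m} x = 0 < toℕ x × suc (toℕ x) < m

below : ∀ {m} {x : Fin m} → Interior x → suc (toℕ (Fin.pred x)) ≡ toℕ x
below {x = zero} (() , _)
below {x = suc x} _ = cong suc (toℕ-inject₁ x)

above : ∀ {m} {x : Fin m} → Interior x → suc (toℕ x) ≡ toℕ (up x)
above {x = x} (_ , lt) = sym (up-step x lt)

some-neighbour : ∀ {m} → 2 ≤ m → (x : Fin m) → Σ (Fin m) λ p → Adjℕ (toℕ x) (toℕ p)
some-neighbour m≥2 zero = up zero , inj₁ (sym (up-step zero m≥2))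
some-neighbour m≥2 (suc x) = inject₁ x , inj₂ (cong suc (toℕ-inject₁ x))

-- On a path with at least three vertices every vertex has an interior
-- neighbour, except possibly vertex 1 when there are exactly three.
interior-neighbour : ∀ {m} → 3 ≤ m → (x : Fin m) → (toℕ x ≡ 1 → 4 ≤ m) →
  Σ (Fin m) λ p → Interior p × Adjℕ (toℕ x) (toℕ p)
interior-neighbour {m} m≥3 zero _ = up zero , (subst (0 <_) (sym one) (s≤s z≤n) , subst (λ t → suc t < m) (sym one) m≥3) , inj₁ (sym one)
  where
  one : toℕ (up zero) ≡ 1
  one = up-step zero (≤-trans (s≤s (s≤s z≤n)) m≥3)
interior-neighbour {m} m≥3 (suc zero) m≥4 = up (suc zero) , (subst (0 <_) (sym two) (s≤s z≤n) , subst (λ t → suc t < m) (sym two) (m≥4 refl)) , inj₁ (sym two)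
  where
  two : toℕ (up (suc zero)) ≡ 2
  two = up-step (suc zero) (≤-trans (s≤s (s≤s (s≤s z≤n))) m≥3)
interior-neighbour m≥3 (suc (suc x)) _ =
  suc (inject₁ x) , (s≤s z≤n , subst (λ t → suc (suc t) < _) (sym inj) (toℕ<n (suc (suc x)))) ,
  inj₂ (cong suc (cong suc inj))
  where
  inj : toℕ (inject₁ x) ≡ toℕ x
  inj = toℕ-inject₁ x

rows-differ : ∀ {M N} {a b : Fin M} {c d : Fin N} → ¬ toℕ a ≡ toℕ b → ¬ (a , c) ≡ (b , d)
rows-differ ne refl = ne refl

cols-differ : ∀ {M N} {a b : Fin M} {c d : Fin N} → ¬ toℕ c ≡ toℕ d → ¬ (a , c) ≡ (b , d)
cols-differ ne refl = ne refl

two-apart : ∀ {a b} → suc (suc a) ≡ b → ¬ a ≡ b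
two-apart {a} e refl = m≢1+n+m a (sym e)

transpose-adj : ∀ {M N} {u v : Fin N × Fin M} → Adj (King N M) u v → Adj (King M N) (swap u) (swap v)
transpose-adj (ne , er , ec) = (λ e → ne (cong swap e)) , ec , er

transpose-near : ∀ {M N} {u v : Fin N × Fin M} → EqOrAdj (King N M) u v → EqOrAdj (King M N) (swap u) (swap v)
transpose-near (inj₁ e) = inj₁ (cong swap e)
transpose-near (inj₂ a) = inj₂ (transpose-adj a)

module Around {M N} {x p : Fin M} {y : Fin N} (xp : Adjℕ (toℕ x) (toℕ p)) (iy : Interior y) where
  yl yr : Fin N
  yl = Fin.pred y
  yr = up y

  l : suc (toℕ yl) ≡ toℕ y
  l = below iy
  r : suc (toℕ y) ≡ toℕ yr
  r = above iy

  x≢p : ∀ {c d : Fin N} → ¬ (x , c) ≡ (p , d)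
  x≢p = rows-differ (adj-≢ xp)
  yl≢y : ∀ {a b : Fin M} → ¬ (a , yl) ≡ (b , y)
  yl≢y = cols-differ (adj-≢ (inj₁ l))
  y≢yl : ∀ {a b : Fin M} → ¬ (a , y) ≡ (b , yl)
  y≢yl = cols-differ (adj-≢ (inj₂ l))
  y≢yr : ∀ {a b : Fin M} → ¬ (a , y) ≡ (b , yr)
  y≢yr = cols-differ (adj-≢ (inj₁ r))
  yl≢yr : ∀ {a b : Fin M} → ¬ (a , yl) ≡ (b , yr)
  yl≢yr = cols-differ (two-apart (trans (cong suc l) r))

  neighbours : Spread 5 (Adj (King M N) (x , y))
  neighbours = xs , ≤-refl , distinct , adjacent
    where
    xs : List (Fin M × Fin N)
    xs = (x , yl) ∷ (x , yr) ∷ (p , yl) ∷ (p , y) ∷ (p , yr) ∷ []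
    distinct : Unique xs
    distinct = (yl≢yr ∷ x≢p ∷ x≢p ∷ x≢p ∷ []) ∷ (x≢p ∷ x≢p ∷ x≢p ∷ []) ∷ (yl≢y ∷ yl≢yr ∷ []) ∷ (y≢yr ∷ []) ∷ [] ∷ []
    adjacent : All (Adj (King M N) (x , y)) xs
    adjacent = (y≢yl , inj₁ refl , inj₂ (inj₂ l)) ∷ (y≢yr , inj₁ refl , inj₂ (inj₁ r)) ∷
               (x≢p , inj₂ xp , inj₂ (inj₂ l)) ∷ (x≢p , inj₂ xp , inj₁ refl) ∷ (x≢p , inj₂ xp , inj₂ (inj₁ r)) ∷ []

  fan-vertices : List (Fin M × Fin N)
  fan-vertices = (x , y) ∷ (p , yl) ∷ (p , y) ∷ (p , yr) ∷ []

  fan-distinct : Unique fan-vertices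
  fan-distinct = (x≢p ∷ x≢p ∷ x≢p ∷ []) ∷ (yl≢y ∷ yl≢yr ∷ []) ∷ (y≢yr ∷ []) ∷ [] ∷ []

  fan-reachable : ∀ {P : Fin M × Fin N → Set} → P (x , y) → P (p , yl) → P (p , y) → P (p , yr) →
    All (λ v → EqOrAdj (King M N) (x , y) v × P v) fan-vertices
  fan-reachable Pxy Pl Pm Pr =
    (inj₁ refl , Pxy) ∷ (king-move (inj₂ xp) (inj₂ (inj₂ l)) , Pl) ∷
    (king-move (inj₂ xp) (inj₁ refl) , Pm) ∷ (king-move (inj₂ xp) (inj₂ (inj₁ r)) , Pr) ∷ []

  fan : ∀ {P : Fin M × Fin N → Set} → P (x , y) → P (p , yl) → P (p , y) → P (p , yr) →
    Spread 4 (λ v → EqOrAdj (King M N) (x , y) v × P v)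
  fan Pxy Pl Pm Pr = fan-vertices , ≤-refl , fan-distinct , fan-reachable Pxy Pl Pm Pr

  fan⁺ : ∀ {P : Fin M × Fin N → Set} {q} → Adjℕ (toℕ y) (toℕ q) → P (x , q) →
    P (x , y) → P (p , yl) → P (p , y) → P (p , yr) → Spread 5 (λ v → EqOrAdj (King M N) (x , y) v × P v)
  fan⁺ {q = q} yq Pxq Pxy Pl Pm Pr =
    (x , q) ∷ fan-vertices , ≤-refl , fresh ∷ fan-distinct ,
    (king-move (inj₁ refl) (inj₂ yq) , Pxq) ∷ fan-reachable Pxy Pl Pm Pr
    where
    fresh : All (λ v → ¬ (x , q) ≡ v) fan-vertices
    fresh = (λ e → cols-differ (adj-≢ yq) (sym e)) ∷ x≢p ∷ x≢p ∷ x≢p ∷ []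

  sidestep : ∀ {P : Fin M × Fin N → Set} {o} → EqOrAdj (Path M) x o →
    P (x , y) → P (p , y) → P (o , yl) → P (o , yr) → Spread 4 (λ v → EqOrAdj (King M N) (x , y) v × P v)
  sidestep {P} {o} xo Pxy Ppy Pl Pr = xs , ≤-refl , distinct , reachable
    where
    xs : List (Fin M × Fin N)
    xs = (x , y) ∷ (p , y) ∷ (o , yl) ∷ (o , yr) ∷ []
    distinct : Unique xs
    distinct = (x≢p ∷ y≢yl ∷ y≢yr ∷ []) ∷ (y≢yl ∷ y≢yr ∷ []) ∷ (yl≢yr ∷ []) ∷ [] ∷ []
    reachable : All (λ v → EqOrAdj (King M N) (x , y) v × P v) xs
    reachable = (inj₁ refl , Pxy) ∷ (king-move (inj₂ xp) (inj₁ refl) , Ppy) ∷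
                (king-move xo (inj₂ (inj₂ l)) , Pl) ∷ (king-move xo (inj₂ (inj₁ r)) , Pr) ∷ []

row-neighbours : ∀ {M N} {x : Fin M} {y q : Fin N} → Interior x → Adjℕ (toℕ y) (toℕ q) →
  Spread 5 (Adj (King M N) (x , y))
row-neighbours ix yq = spread-map swap (cong swap) transpose-adj (Around.neighbours yq ix)

HasInterior : ∀ {M N} → Fin M × Fin N → Set
HasInterior (x , y) = Interior x ⊎ Interior y

interior-neighbours : ∀ {M N} → 2 ≤ M → 2 ≤ N → ∀ r → HasInterior r → Spread 5 (Adj (King M N) r)
interior-neighbours M≥2 N≥2 (x , y) (inj₁ ix) = row-neighbours ix (proj₂ (some-neighbour N≥2 y))
interior-neighbours M≥2 N≥2 (x , y) (inj₂ iy) = Around.neighbours (proj₂ (some-neighbour M≥2 x)) iy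

module Square {M N} {x p : Fin M} {y q : Fin N} (xp : Adjℕ (toℕ x) (toℕ p)) (yq : Adjℕ (toℕ y) (toℕ q)) where
  x≢p : ∀ {c d : Fin N} → ¬ (x , c) ≡ (p , d)
  x≢p = rows-differ (adj-≢ xp)
  y≢q : ∀ {a b : Fin M} → ¬ (a , y) ≡ (b , q)
  y≢q = cols-differ (adj-≢ yq)

  neighbours : Spread 3 (Adj (King M N) (x , y))
  neighbours = xs , ≤-refl , distinct , adjacent
    where
    xs : List (Fin M × Fin N)
    xs = (p , y) ∷ (x , q) ∷ (p , q) ∷ []
    distinct : Unique xs
    distinct = ((λ e → x≢p (sym e)) ∷ y≢q ∷ []) ∷ (x≢p ∷ []) ∷ [] ∷ []
    adjacent : All (Adj (King M N) (x , y)) xs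
    adjacent = (x≢p , inj₂ xp , inj₁ refl) ∷ (y≢q , inj₁ refl , inj₂ yq) ∷ (x≢p , inj₂ xp , inj₂ yq) ∷ []

  moves : ∀ {P : Fin M × Fin N → Set} → P (x , y) → P (p , y) → P (x , q) → P (p , q) →
    Spread 4 (λ v → EqOrAdj (King M N) (x , y) v × P v)
  moves {P} Pxy Ppy Pxq Ppq = xs , ≤-refl , distinct , reachable
    where
    xs : List (Fin M × Fin N)
    xs = (x , y) ∷ (p , y) ∷ (x , q) ∷ (p , q) ∷ []
    distinct : Unique xs
    distinct = (x≢p ∷ y≢q ∷ x≢p ∷ []) ∷ ((λ e → x≢p (sym e)) ∷ y≢q ∷ []) ∷ (x≢p ∷ []) ∷ [] ∷ []
    reachable : All (λ v → EqOrAdj (King M N) (x , y) v × P v) xs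
    reachable = (inj₁ refl , Pxy) ∷ (king-move (inj₂ xp) (inj₁ refl) , Ppy) ∷
                (king-move (inj₁ refl) (inj₂ yq) , Pxq) ∷ (king-move (inj₂ xp) (inj₂ yq) , Ppq) ∷ []

_≟ᵛ_ : ∀ {M N} → DecidableEquality (Fin M × Fin N)
_≟ᵛ_ = ≡-dec _≟ᶠ_ _≟ᶠ_

interior? : ∀ {m} (x : Fin m) → Dec (Interior x)
interior? {m} x = (0 <? toℕ x) ×-dec (suc (toℕ x) <? m)

large-board-escape : ∀ {m n} → 4 ≤ m → 4 ≤ n → ∀ j → j < 5 → ¬ Game.CopsWin (King m n) j
large-board-escape {m} {n} m≥4 n≥4 j j<5 =
  Escape.robberWins _≟ᵛ_ j HasInterior
    (λ r g → spread-weaken j<5 (interior-neighbours (≤-trans (s≤s (s≤s z≤n)) m≥4) (≤-trans (s≤s (s≤s z≤n)) n≥4) r g))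
    (λ r g → spread-weaken j<5 (moves r g))
    ((proj₁ (inward m≥4 (first m≥4)) , first n≥4) , inj₁ (proj₁ (proj₂ (inward m≥4 (first m≥4)))))
  where
  first : ∀ {M} → 4 ≤ M → Fin M
  first M≥4 = fromℕ< (≤-trans (s≤s z≤n) M≥4)

  inward : ∀ {M} → 4 ≤ M → (x : Fin M) → Σ (Fin M) λ p → Interior p × Adjℕ (toℕ x) (toℕ p)
  inward M≥4 x = interior-neighbour (≤-trans (n≤1+n 3) M≥4) x (λ _ → M≥4)

  -- from (x , y) on an interior column: stay, move along row x to an interior
  -- column q, or move to the three vertices of an interior row p next to x
  column-moves : ∀ {M N} → 4 ≤ M → 4 ≤ N → (x : Fin M) (y : Fin N) → Interior y →
    Spread 5 (λ v → EqOrAdj (King M N) (x , y) v × HasInterior v)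
  column-moves M≥4 N≥4 x y iy with inward M≥4 x | inward N≥4 y
  ... | p , ip , xp | q , iq , yq = Around.fan⁺ xp iy yq (inj₂ iq) (inj₂ iy) (inj₁ ip) (inj₁ ip) (inj₁ ip)

  moves : ∀ r → HasInterior r → Spread 5 (λ v → EqOrAdj (King m n) r v × HasInterior v)
  moves (x , y) (inj₂ iy) = column-moves m≥4 n≥4 x y iy
  moves (x , y) (inj₁ ix) =
    spread-map swap (cong swap) (λ { (e , g) → transpose-near e , Data.Sum.swap g }) (column-moves n≥4 m≥4 y x ix)

three-rows-escape : ∀ {n} → 3 ≤ n → ∀ j → j < 4 → ¬ Game.CopsWin (King 3 n) j
three-rows-escape {n} n≥3 j j<4 =
  Escape.robberWins _≟ᵛ_ j HasInterior
    (λ r g → spread-weaken (≤-trans j<4 (n≤1+n 4)) (interior-neighbours (s≤s (s≤s z≤n)) (≤-trans (n≤1+n 2) n≥3) r g))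
    (λ r g → spread-weaken j<4 (moves r g))
    ((middle , fromℕ< (≤-trans (s≤s z≤n) n≥3)) , inj₁ middle-interior)
  where
  middle : Fin 3
  middle = suc zero

  middle-interior : Interior middle
  middle-interior = s≤s z≤n , s≤s (s≤s (s≤s z≤n))

  only-middle : ∀ {x : Fin 3} → Interior x → x ≡ middle
  only-middle {zero} (() , _)
  only-middle {suc zero} _ = refl
  only-middle {suc (suc zero)} (_ , s≤s (s≤s (s≤s ())))

  to-middle : ∀ (x : Fin 3) → EqOrAdj (Path 3) x middle
  to-middle zero = inj₂ (inj₁ refl)
  to-middle (suc zero) = inj₁ refl
  to-middle (suc (suc zero)) = inj₂ (inj₂ refl)

  interior-one : ∀ {y : Fin n} → toℕ y ≡ 1 → Interior y
  interior-one y≡1 = subst (0 <_) (sym y≡1) (s≤s z≤n) , subst (λ t → suc t < n) (sym y≡1) n≥3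

  -- on an interior column: stay, step to a neighbouring row, or move diagonally
  -- onto the middle row; on a border column the robber is on the middle row and
  -- moves into the neighbouring interior column (the transposed fan)
  moves : ∀ r → HasInterior r → Spread 4 (λ v → EqOrAdj (King 3 n) r v × HasInterior v)
  moves (x , y) g with interior? y
  ... | yes iy = Around.sidestep (proj₂ (some-neighbour (s≤s (s≤s z≤n)) x)) iy (to-middle x)
                   (inj₂ iy) (inj₂ iy) (inj₁ middle-interior) (inj₁ middle-interior)
  ... | no ¬iy with g
  ...   | inj₂ iy = ⊥-elim (¬iy iy)
  ...   | inj₁ ix rewrite only-middle ix with interior-neighbour n≥3 y (λ y≡1 → ⊥-elim (¬iy (interior-one y≡1)))
  ...     | q , iq , yq =
    spread-map swap (cong swap) (λ { (e , g) → transpose-near e , Data.Sum.swap g })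
      (Around.fan yq middle-interior {P = HasInterior} (inj₂ middle-interior) (inj₁ iq) (inj₁ iq) (inj₁ iq))

two-rows-escape : ∀ {n} → 4 ≤ n → ∀ j → j < 4 → ¬ Game.CopsWin (King 2 n) j
two-rows-escape {n} n≥4 j j<4 =
  Escape.robberWins _≟ᵛ_ j Good
    (λ { (x , y) iy → spread-weaken (≤-trans j<4 (n≤1+n 4)) (Around.neighbours (proj₂ (some-neighbour ≤-refl x)) iy) })
    (λ r g → spread-weaken j<4 (moves r g))
    ((zero , proj₁ (inward first)) , proj₁ (proj₂ (inward first)))
  where
  first : Fin n
  first = fromℕ< (≤-trans (s≤s z≤n) n≥4)

  Good : Fin 2 × Fin n → Set
  Good (_ , y) = Interior y

  inward : (y : Fin n) → Σ (Fin n) λ q → Interior q × Adjℕ (toℕ y) (toℕ q)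
  inward y = interior-neighbour (≤-trans (n≤1+n 3) n≥4) y (λ _ → n≥4)

  moves : ∀ r → Good r → Spread 4 (λ v → EqOrAdj (King 2 n) r v × Good v)
  moves (x , y) iy with inward y
  ... | q , iq , yq = Square.moves (proj₂ (some-neighbour ≤-refl x)) yq iy iy iq iq

small-board-escape : ∀ {n} → 2 ≤ n → ∀ j → j < 3 → ¬ Game.CopsWin (King 2 n) j
small-board-escape {n} n≥2 j j<3 =
  Escape.robberWins _≟ᵛ_ j (λ _ → ⊤)
    (λ { (x , y) _ → spread-weaken j<3 (Square.neighbours (proj₂ (some-neighbour ≤-refl x)) (proj₂ (some-neighbour n≥2 y))) })
    (λ { (x , y) _ → spread-weaken (≤-trans j<3 (n≤1+n 3))
           (Square.moves (proj₂ (some-neighbour ≤-refl x)) (proj₂ (some-neighbour n≥2 y)) {P = λ _ → ⊤} tt tt tt tt) })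
    ((zero , fromℕ< (≤-trans (s≤s z≤n) n≥2)) , tt)

five-cops : ∀ m n → 1 ≤ m → 1 ≤ n → Game.CopsWin (King m n) 5
five-cops (suc m) (suc n) _ _ = FiveCops.copsWin m n

four-cops-two-rows : ∀ n → 1 ≤ n → Game.CopsWin (King 2 n) 4
four-cops-two-rows (suc n) _ = TwoRows.copsWin n

four-cops-three-rows : ∀ n → 1 ≤ n → Game.CopsWin (King 3 n) 4
four-cops-three-rows (suc n) _ = ThreeRows.copsWin n

three-cops-small : ∀ n → 2 ≤ n → n ≤ 3 → Game.CopsWin (King 2 n) 3
three-cops-small 1 (s≤s ()) _
three-cops-small 2 _ _ = TwoByTwo.copsWin
three-cops-small 3 _ _ = TwoByThree.copsWin
three-cops-small (suc (suc (suc (suc _)))) _ (s≤s (s≤s (s≤s ())))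

theorem18 : (m n : ℕ) → 2 ≤ m → m ≤ n →
    (4 ≤ m → SurroundingCopNumberIs (Path m ⊠ Path n) 5)
    × ((m ≡ 3 ⊎ (m ≡ 2 × 4 ≤ n)) → SurroundingCopNumberIs (Path m ⊠ Path n) 4)
    × (m ≡ 2 → n ≤ 3 → SurroundingCopNumberIs (Path m ⊠ Path n) 3)
theorem18 m n m≥2 m≤n = large , medium , small
  where
  m≥1 : 1 ≤ m
  m≥1 = ≤-trans (s≤s z≤n) m≥2

  n≥1 : 1 ≤ n
  n≥1 = ≤-trans m≥1 m≤n

  large : 4 ≤ m → SurroundingCopNumberIs (Path m ⊠ Path n) 5
  large m≥4 = five-cops m n m≥1 n≥1 , λ j _ → large-board-escape m≥4 (≤-trans m≥4 m≤n) j

  medium : (m ≡ 3 ⊎ (m ≡ 2 × 4 ≤ n)) → SurroundingCopNumberIs (Path m ⊠ Path n) 4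
  medium (inj₁ refl) = four-cops-three-rows n n≥1 , λ j _ → three-rows-escape m≤n j
  medium (inj₂ (refl , n≥4)) = four-cops-two-rows n n≥1 , λ j _ → two-rows-escape n≥4 j

  small : m ≡ 2 → n ≤ 3 → SurroundingCopNumberIs (Path m ⊠ Path n) 3
  small refl n≤3 = three-cops-small n m≤n n≤3 , λ j _ → small-board-escape m≤n j
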